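{- Let $S$ be a Hilbert-style proof system for the implicational propositional language whose only inference rule is modus ponens and whose axioms include all instances of the schemes $A \supset (B \supset A)$ and $[A \supset (B \supset C)] \supset [(A \supset B) \supset (A \supset C)]$ (and possibly instances of further axiom schemes). Then every instance of the Peirce scheme $[(A \supset B) \supset A] \supset A$ is a theorem of $S$ if and only if for all well-formed formulas $A, B, Q$ we have $A \supset Q,\ B \supset Q \vdash_S (A \vee B) \supset Q$, where $A \vee B$ abbreviates $(A \supset B) \supset B$.
   Context: The implicational propositional language has propositional variables and the single binary connective $\supset$; well-formed formulas are built from variables using $\supset$. $\Gamma \vdash_S C$ means $C$ is deducible in $S$ from the hypotheses $\Gamma$ using the axioms of $S$ and modus ponens (from $A$ and $A \supset B$ infer $B$); a theorem of $S$ is a formula deducible from no hypotheses. The notation $A \vee B$ is an abbreviation for $(A \supset B) \supset B$. -}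

module Defs where

open import Data.Nat using (ℕ)
open import Data.List using (List; []; _∷_)
open import Data.List.Membership.Propositional using (_∈_)

data Formula : Set where
  var : ℕ → Formula
  _⊃_ : Formula → Formula → Formula

infixr 5 _⊃_

_∨_ : Formula → Formula → Formula
A ∨ B = (A ⊃ B) ⊃ B

infixl 6 _∨_

Subst : Set
Subst = ℕ → Formula

_[_] : Formula → Subst → Formula
var n [ σ ] = σ n
(A ⊃ B) [ σ ] = (A [ σ ]) ⊃ (B [ σ ])

data _⊢[_]_ (Γ : List Formula) (Ax : Formula → Set) : Formula → Set where
  hyp : ∀ {A} → A ∈ Γ → Γ ⊢[ Ax ] A
  ax  : ∀ {A} → Ax A → Γ ⊢[ Ax ] A
  mp  : ∀ {A B} → Γ ⊢[ Ax ] A → Γ ⊢[ Ax ] (A ⊃ B) → Γ ⊢[ Ax ] B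

Theorem : (Formula → Set) → Formula → Set
Theorem Ax C = [] ⊢[ Ax ] C

SchematicAxioms : (Formula → Set) → Set
SchematicAxioms Ax = ∀ {A} (σ : Subst) → Ax A → Ax (A [ σ ])

HasK : (Formula → Set) → Set
HasK Ax = ∀ A B → Ax (A ⊃ (B ⊃ A))

HasS : (Formula → Set) → Set
HasS Ax = ∀ A B C → Ax ((A ⊃ (B ⊃ C)) ⊃ ((A ⊃ B) ⊃ (A ⊃ C)))

PeirceInstance : Formula → Formula → Formula
PeirceInstance A B = ((A ⊃ B) ⊃ A) ⊃ A

-- Both conditions only use the deduction theorem, which needs nothing but the
-- K and S schemes.  Given Peirce's law ((Q ⊃ B) ⊃ Q) ⊃ Q, the hypotheses
-- A ⊃ Q, B ⊃ Q and A ∨ B yield (Q ⊃ B) ⊃ Q, since Q ⊃ B and A ⊃ Q give A ⊃ B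
-- and hence B.  Conversely, take Q to be the Peirce formula ((A ⊃ B) ⊃ A) ⊃ A:
-- both A ⊃ Q and (A ⊃ B) ⊃ Q are provable, and so is A ∨ (A ⊃ B), which is
-- just the contraction law (A ⊃ (A ⊃ B)) ⊃ (A ⊃ B).
module Submission where

open import Defs
open import Data.List using (List; []; _∷_)
open import Function.Bundles using (_⇔_; mk⇔)
open import Data.List.Membership.Propositional using (_∈_)
open import Data.List.Relation.Unary.Any using (here; there)
open import Relation.Binary.PropositionalEquality using (refl)

module Hilbert (Ax : Formula → Set) where

  infix 3 _⊢_

  _⊢_ : List Formula → Formula → Set
  Γ ⊢ C = Γ ⊢[ Ax ] C

  cut : ∀ {Γ Δ C} → (∀ {D} → D ∈ Γ → Δ ⊢ D) → Γ ⊢ C → Δ ⊢ C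
  cut f (hyp p)  = f p
  cut f (ax a)   = ax a
  cut f (mp d e) = mp (cut f d) (cut f e)

  weaken : ∀ {Γ D C} → Γ ⊢ C → D ∷ Γ ⊢ C
  weaken = cut (λ p → hyp (there p))

  closed : ∀ {Γ C} → [] ⊢ C → Γ ⊢ C
  closed = cut (λ ())

  #0 : ∀ {Γ A} → A ∷ Γ ⊢ A
  #0 = hyp (here refl)

  #1 : ∀ {Γ A B} → B ∷ A ∷ Γ ⊢ A
  #1 = hyp (there (here refl))

  module _ (K : HasK Ax) (S : HasS Ax) where

    ⊃-refl : ∀ {Γ} A → Γ ⊢ A ⊃ A
    ⊃-refl A = mp (ax (K A A)) (mp (ax (K A (A ⊃ A))) (ax (S A (A ⊃ A) A)))

    deduction : ∀ {Γ A B} → A ∷ Γ ⊢ B → Γ ⊢ A ⊃ B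
    deduction {A = A} (hyp (here refl)) = ⊃-refl A
    deduction {A = A} (hyp (there p))   = mp (hyp p) (ax (K _ A))
    deduction {A = A} (ax a)            = mp (ax a) (ax (K _ A))
    deduction {A = A} (mp d e)          = mp (deduction d) (mp (deduction e) (ax (S A _ _)))

    ⊃-trans : ∀ {Γ A B C} → Γ ⊢ A ⊃ B → Γ ⊢ B ⊃ C → Γ ⊢ A ⊃ C
    ⊃-trans f g = deduction (mp (mp #0 (weaken f)) (weaken g))

    contraction : ∀ {Γ} A B → Γ ⊢ (A ⊃ (A ⊃ B)) ⊃ (A ⊃ B)
    contraction A B = deduction (deduction (mp #0 (mp #0 #1)))

    peirce⇒∨-elim : ∀ {A B Q} → Theorem Ax (PeirceInstance Q B) →
                    (A ⊃ Q) ∷ (B ⊃ Q) ∷ [] ⊢ (A ∨ B) ⊃ Q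
    peirce⇒∨-elim {A} {B} {Q} peirce = deduction (mp [Q⊃B]⊃Q (closed peirce))
      where
      [Q⊃B]⊃Q : (A ∨ B) ∷ (A ⊃ Q) ∷ (B ⊃ Q) ∷ [] ⊢ (Q ⊃ B) ⊃ Q
      [Q⊃B]⊃Q = deduction (mp (mp (⊃-trans (weaken #1) #0) #1) (weaken (weaken #1)))

    ∨-elim⇒peirce : ∀ {A B} →
                    (A ⊃ PeirceInstance A B) ∷ ((A ⊃ B) ⊃ PeirceInstance A B) ∷ []
                      ⊢ (A ∨ (A ⊃ B)) ⊃ PeirceInstance A B →
                    Theorem Ax (PeirceInstance A B)
    ∨-elim⇒peirce {A} {B} ∨-elim = mp (contraction A B) (cut premises ∨-elim)
      where
      premises : ∀ {D} → D ∈ (A ⊃ PeirceInstance A B) ∷ ((A ⊃ B) ⊃ PeirceInstance A B) ∷ [] →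
                 [] ⊢ D
      premises (here refl)         = ax (K A ((A ⊃ B) ⊃ A))
      premises (there (here refl)) = deduction (deduction (mp #1 #0))

theorem4 : (Ax : Formula → Set) → SchematicAxioms Ax → HasK Ax → HasS Ax →
    ((∀ A B → Theorem Ax (PeirceInstance A B)) ⇔
    (∀ A B Q → ((A ⊃ Q) ∷ (B ⊃ Q) ∷ []) ⊢[ Ax ] ((A ∨ B) ⊃ Q)))
theorem4 Ax _ K S = mk⇔
  (λ peirce A B Q → peirce⇒∨-elim K S (peirce Q B))
  (λ ∨-elim A B → ∨-elim⇒peirce K S (∨-elim A (A ⊃ B) (PeirceInstance A B)))
  where open Hilbert Ax
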